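{- Let $G=(X,E)$ be a symmetric 2-structure, $\mathcal{I}$ an involution of its colours without fixed point, and let $U,V$ be two crossing involution modules of $G$. Then the symmetric difference $U\triangle V$ is an involution module of $G$.
   Context: A (symmetric) 2-structure is a pair $G=(X,E)$ with $X$ finite and $E:X^2\to\mathbb{N}$ symmetric; its colour set is $C=\{E(u,v):u\neq v\}$. For $s\in X$, $i\in C$, $X'\subseteq X$, $N^i_s(X')=\{x\in X':E(s,x)=i\}$. Given an involution $\mathcal{I}$ of $C$ without fixed point, $U\subseteq X$ is an involution module if for all $u,v\in U$, either $N^i_u(X\setminus U)=N^{\mathcal{I}(i)}_v(X\setminus U)$ for all $i\in C$, or $N^i_u(X\setminus U)=N^{i}_v(X\setminus U)$ for all $i\in C$. Two sets $A,B\subseteq X$ are crossing if $A\cap B$, $A\setminus B$, $B\setminus A$ are all nonempty and $A\cup B\neq X$. -}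

module Defs where

open import Data.Nat using (ℕ)
open import Data.Fin using (Fin)
open import Data.Fin.Subset using (Subset; _∈_; _∉_; _∩_; _∪_; _─_; Nonempty)
open import Data.Product using (_×_; ∃-syntax; Σ-syntax)
open import Data.Sum using (_⊎_)
open import Relation.Binary.PropositionalEquality using (_≡_; _≢_)
open import Relation.Nullary using (¬_)
open import Function.Bundles using (_⇔_)

record TwoStructure (n : ℕ) : Set where
  field
    E   : Fin n → Fin n → ℕ
    sym : ∀ x y → E x y ≡ E y x

module _ {n : ℕ} (G : TwoStructure n) where
  open TwoStructure G

  InC : ℕ → Set
  InC i = ∃[ u ] ∃[ v ] (u ≢ v × E u v ≡ i)

  -- An involution of C without fixed point (given as a map ℕ → ℕ whose
  -- restriction to C is a fixed-point-free involution of C).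
  record FPFInvolution : Set where
    field
      I        : ℕ → ℕ
      closed   : ∀ i → InC i → InC (I i)
      invol    : ∀ i → InC i → I (I i) ≡ i
      noFixed  : ∀ i → InC i → I i ≢ i

  SameNbhd : Subset n → Fin n → ℕ → Fin n → ℕ → Set
  SameNbhd U s i t j = ∀ x → x ∉ U → (E s x ≡ i ⇔ E t x ≡ j)

  IsInvolutionModule : FPFInvolution → Subset n → Set
  IsInvolutionModule 𝓘 U =
    ∀ u v → u ∈ U → v ∈ U →
      (∀ i → InC i → SameNbhd U u i v (FPFInvolution.I 𝓘 i))
      ⊎ (∀ i → InC i → SameNbhd U u i v i)

Crossing : {n : ℕ} → Subset n → Subset n → Set
Crossing {n} A B =
  Nonempty (A ∩ B) × Nonempty (A ─ B) × Nonempty (B ─ A) × (∃[ x ] x ∉ A ∪ B)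

_△_ : {n : ℕ} → Subset n → Subset n → Subset n
A △ B = (A ─ B) ∪ (B ─ A)

-- Record how two vertices of a module see the outside by one bit: whether the
-- colours seen from v are those seen from u, or their images under I.  Since I
-- is an involution these bits compose by xor, and since I has no fixed point
-- one colour determines the bit.  A point outside U △ V lies in U ∩ V or
-- outside U ∪ V.  Outside U ∪ V the bit for U (or for V) applies directly;
-- on U ∩ V it is transported through a witness of the crossing: a vertex of
-- V ─ U when u and v lie on the same side, and a vertex of U ∩ V (whose bits
-- for U and V agree, by looking at a vertex outside U ∪ V) otherwise.
module Submission where

open import Defs
open import Data.Nat using (ℕ)
open import Data.Fin using (Fin)
open import Data.Fin.Subset using (Subset; _∈_; _∉_; _─_; inside; outside)
open import Data.Fin.Subset.Properties
  using (_∈?_; x∈p∩q⁻; x∈p∪q⁻; x∈p∪q⁺; x∈p∧x∉q⇒x∈p─q; p─q⊆p; ∪-comm)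
open import Data.Vec using (_∷_; there)
open import Data.Bool using (Bool; true; false; _xor_)
open import Data.Bool.Properties
  using (not-involutive; xor-assoc; xor-same; xor-identityʳ)
open import Data.Product using (_×_; _,_; ∃-syntax; proj₁; proj₂)
open import Data.Sum using (_⊎_; inj₁; inj₂)
open import Function using (id; _∘′_)
open import Function.Bundles using (mk⇔; Equivalence)
open import Relation.Binary.PropositionalEquality
open import Relation.Nullary using (yes; no; contradiction)

x∈p─q⇒x∉q : ∀ {n} {x : Fin n} (p q : Subset n) → x ∈ p ─ q → x ∉ q
x∈p─q⇒x∉q (_ ∷ p) (inside  ∷ q) (there x∈p─q) (there x∈q) = x∈p─q⇒x∉q p q x∈p─q x∈q
x∈p─q⇒x∉q (_ ∷ p) (outside ∷ q) (there x∈p─q) (there x∈q) = x∈p─q⇒x∉q p q x∈p─q x∈q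

xor-cancelˡ : ∀ c a b → (c xor a) xor (c xor b) ≡ a xor b
xor-cancelˡ false a     b = refl
xor-cancelˡ true  true  b = refl
xor-cancelˡ true  false b = not-involutive b

module _ {n : ℕ} where

  △-comm : (U V : Subset n) → U △ V ≡ V △ U
  △-comm U V = ∪-comm (U ─ V) (V ─ U)

  x∈p△q⁻ : ∀ (p q : Subset n) {x} → x ∈ p △ q → (x ∈ p × x ∉ q) ⊎ (x ∈ q × x ∉ p)
  x∈p△q⁻ p q x∈p△q with x∈p∪q⁻ (p ─ q) (q ─ p) x∈p△q
  ... | inj₁ x∈p─q = inj₁ (p─q⊆p p q x∈p─q , x∈p─q⇒x∉q p q x∈p─q)
  ... | inj₂ x∈q─p = inj₂ (p─q⊆p q p x∈q─p , x∈p─q⇒x∉q q p x∈q─p)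

  x∉p△q⁻ : ∀ (p q : Subset n) {x} → x ∉ p △ q → (x ∈ p × x ∈ q) ⊎ (x ∉ p × x ∉ q)
  x∉p△q⁻ p q {x} x∉p△q with x ∈? p | x ∈? q
  ... | yes x∈p | yes x∈q = inj₁ (x∈p , x∈q)
  ... | no  x∉p | no  x∉q = inj₂ (x∉p , x∉q)
  ... | yes x∈p | no  x∉q = contradiction (x∈p∪q⁺ (inj₁ (x∈p∧x∉q⇒x∈p─q x∈p x∉q))) x∉p△q
  ... | no  x∉p | yes x∈q = contradiction (x∈p∪q⁺ (inj₂ (x∈p∧x∉q⇒x∈p─q x∈q x∉p))) x∉p△q

  ∈∉⇒≢ : ∀ {W : Subset n} {u x} → u ∈ W → x ∉ W → u ≢ x
  ∈∉⇒≢ u∈W x∉W refl = x∉W u∈W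

module _ {n : ℕ} (G : TwoStructure n) (𝓘 : FPFInvolution G) where
  open TwoStructure G renaming (sym to E-sym)
  open FPFInvolution 𝓘
  open ≡-Reasoning

  twist : Bool → ℕ → ℕ
  twist false = id
  twist true  = I

  E∈C : ∀ {u x} → u ≢ x → InC G (E u x)
  E∈C u≢x = _ , _ , u≢x , refl

  twist-involutive : ∀ b {k} → InC G k → twist b (twist b k) ≡ k
  twist-involutive false k∈C = refl
  twist-involutive true  k∈C = invol _ k∈C

  twist-xor : ∀ a b {k} → InC G k → twist a (twist b k) ≡ twist (a xor b) k
  twist-xor false b     k∈C = refl
  twist-xor true  false k∈C = refl
  twist-xor true  true  k∈C = invol _ k∈C

  twist-comm : ∀ a b k → twist a (twist b k) ≡ twist b (twist a k)
  twist-comm false b     k = refl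
  twist-comm true  false k = refl
  twist-comm true  true  k = refl

  twist-injective : ∀ a b {k} → InC G k → twist a k ≡ twist b k → a ≡ b
  twist-injective false false k∈C eq = refl
  twist-injective true  true  k∈C eq = refl
  twist-injective false true  k∈C eq = contradiction (sym eq) (noFixed _ k∈C)
  twist-injective true  false k∈C eq = contradiction eq (noFixed _ k∈C)

  twist-relative : ∀ p q {k y z} → InC G k →
    y ≡ twist p k → z ≡ twist q k → y ≡ twist (p xor q) z
  twist-relative p q {k} {y} {z} k∈C y≡ z≡ = begin
    y                             ≡⟨ y≡ ⟩
    twist p k                     ≡⟨ cong (λ b → twist b k) p≡p⊕q⊕q ⟩
    twist ((p xor q) xor q) k     ≡⟨ twist-xor (p xor q) q k∈C ⟨
    twist (p xor q) (twist q k)   ≡⟨ cong (twist (p xor q)) z≡ ⟨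
    twist (p xor q) z             ∎
    where
    p≡p⊕q⊕q : p ≡ (p xor q) xor q
    p≡p⊕q⊕q = sym (trans (xor-assoc p q q)
                         (trans (cong (p xor_) (xor-same q)) (xor-identityʳ p)))

  Twisted : Subset n → Fin n → Bool → Fin n → Set
  Twisted W u b v = ∀ x → x ∉ W → E v x ≡ twist b (E u x)

  IsTwistModule : Subset n → Set
  IsTwistModule W = ∀ {u v} → u ∈ W → v ∈ W → ∃[ b ] Twisted W u b v

  twisted-sym : ∀ {W u v} b → u ∈ W → Twisted W u b v → Twisted W v b u
  twisted-sym {u = u} {v} b u∈W u→v x x∉W = begin
    E u x                     ≡⟨ twist-involutive b (E∈C (∈∉⇒≢ u∈W x∉W)) ⟨
    twist b (twist b (E u x)) ≡⟨ cong (twist b) (u→v x x∉W) ⟨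
    twist b (E v x)           ∎

  involutionModule⇒twistModule : ∀ {W} → IsInvolutionModule G 𝓘 W → IsTwistModule W
  involutionModule⇒twistModule M {u} {v} u∈W v∈W with M u v u∈W v∈W
  ... | inj₁ twisted  = true  , λ x x∉W →
          Equivalence.to (twisted (E u x) (E∈C (∈∉⇒≢ u∈W x∉W)) x x∉W) refl
  ... | inj₂ straight = false , λ x x∉W →
          Equivalence.to (straight (E u x) (E∈C (∈∉⇒≢ u∈W x∉W)) x x∉W) refl

  twistModule⇒involutionModule : ∀ {W} → IsTwistModule W → IsInvolutionModule G 𝓘 W
  twistModule⇒involutionModule M u v u∈W v∈W with M u∈W v∈W
  ... | true  , u→v = inj₁ λ i i∈C x x∉W → mk⇔
          (λ Eux≡i → trans (u→v x x∉W) (cong I Eux≡i))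
          (λ Evx≡Ii → begin
            E u x         ≡⟨ invol _ (E∈C (∈∉⇒≢ u∈W x∉W)) ⟨
            I (I (E u x)) ≡⟨ cong I (trans (sym (u→v x x∉W)) Evx≡Ii) ⟩
            I (I i)       ≡⟨ invol i i∈C ⟩
            i             ∎)
  ... | false , u→v = inj₂ λ i i∈C x x∉W → mk⇔
          (trans (u→v x x∉W)) (trans (sym (u→v x x∉W)))

  module _ {U V : Subset n} (MU : IsTwistModule U) (MV : IsTwistModule V) where

    twisted-△-sameSide : ∀ {c u v} → c ∈ V → c ∉ U →
      u ∈ U → u ∉ V → v ∈ U → v ∉ V → ∃[ b ] Twisted (U △ V) u b v
    twisted-△-sameSide {c} {u} {v} cV cU uU uV vU vV with MU uU vU
    ... | τ , u→v = τ , twisted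
      where
      twisted : Twisted (U △ V) u τ v
      twisted x x∉ with x∉p△q⁻ U V x∉
      ... | inj₂ (xU , _) = u→v x xU
      ... | inj₁ (_ , xV) with MV cV xV
      ...   | σ , c→x = begin
        E v x                     ≡⟨ E-sym v x ⟩
        E x v                     ≡⟨ c→x v vV ⟩
        twist σ (E c v)           ≡⟨ cong (twist σ) (trans (E-sym c v) (u→v c cU)) ⟩
        twist σ (twist τ (E u c)) ≡⟨ twist-comm σ τ (E u c) ⟩
        twist τ (twist σ (E u c)) ≡⟨ cong (twist τ) (trans (cong (twist σ) (E-sym u c))
                                                           (sym (c→x u uV))) ⟩
        twist τ (E x u)           ≡⟨ cong (twist τ) (E-sym x u) ⟩
        twist τ (E u x)           ∎

    twisted-△-acrossSides : ∀ {a d u v} → a ∈ U → a ∈ V → d ∉ U → d ∉ V →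
      u ∈ U → u ∉ V → v ∈ V → v ∉ U → ∃[ b ] Twisted (U △ V) u b v
    twisted-△-acrossSides {a} {d} {u} {v} aU aV dU dV uU uV vV vU
      with MU uU aU | MV aV vV
    ... | α , u→a | β , a→v = α xor β , twisted
      where
      twisted : Twisted (U △ V) u (α xor β) v
      twisted x x∉ with x∉p△q⁻ U V x∉
      ... | inj₂ (xU , xV) = begin
        E v x                     ≡⟨ a→v x xV ⟩
        twist β (E a x)           ≡⟨ cong (twist β) (u→a x xU) ⟩
        twist β (twist α (E u x)) ≡⟨ twist-comm β α (E u x) ⟩
        twist α (twist β (E u x)) ≡⟨ twist-xor α β (E∈C (∈∉⇒≢ uU xU)) ⟩
        twist (α xor β) (E u x)   ∎
      ... | inj₁ (xU , xV) with MU aU xU | MV aV xV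
      ...   | γ , a→xᵁ | δ , a→xⱽ =
        subst (λ b → E v x ≡ twist b (E u x)) (xor-cancelˡ γ α β)
              (twist-relative (γ xor α) (γ xor β) (E∈C (∈∉⇒≢ uU vU)) Evx Eux)
        where
        γ≡δ : γ ≡ δ
        γ≡δ = twist-injective γ δ (E∈C (∈∉⇒≢ aU dU))
                (trans (sym (a→xᵁ d dU)) (a→xⱽ d dV))

        Evx : E v x ≡ twist (γ xor α) (E u v)
        Evx = begin
          E v x                     ≡⟨ E-sym v x ⟩
          E x v                     ≡⟨ a→xᵁ v vU ⟩
          twist γ (E a v)           ≡⟨ cong (twist γ) (u→a v vU) ⟩
          twist γ (twist α (E u v)) ≡⟨ twist-xor γ α (E∈C (∈∉⇒≢ uU vU)) ⟩
          twist (γ xor α) (E u v)   ∎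

        Eux : E u x ≡ twist (γ xor β) (E u v)
        Eux = begin
          E u x                     ≡⟨ E-sym u x ⟩
          E x u                     ≡⟨ a→xⱽ u uV ⟩
          twist δ (E a u)           ≡⟨ cong (λ b → twist b (E a u)) γ≡δ ⟨
          twist γ (E a u)           ≡⟨ cong (twist γ) (twisted-sym β aV a→v u uV) ⟩
          twist γ (twist β (E v u)) ≡⟨ cong (twist γ ∘′ twist β) (E-sym v u) ⟩
          twist γ (twist β (E u v)) ≡⟨ twist-xor γ β (E∈C (∈∉⇒≢ uU vU)) ⟩
          twist (γ xor β) (E u v)   ∎

  △-isTwistModule : ∀ {U V} → IsTwistModule U → IsTwistModule V → Crossing U V →
    IsTwistModule (U △ V)
  △-isTwistModule {U} {V} MU MV ((a , a∈U∩V) , (b , b∈U─V) , (c , c∈V─U) , (d , d∉U∪V))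
    {u} {v} u∈U△V v∈U△V = twisted-△ (x∈p△q⁻ U V u∈U△V) (x∈p△q⁻ U V v∈U△V)
    where
    aU : a ∈ U
    aU = proj₁ (x∈p∩q⁻ U V a∈U∩V)
    aV : a ∈ V
    aV = proj₂ (x∈p∩q⁻ U V a∈U∩V)
    bU : b ∈ U
    bU = p─q⊆p U V b∈U─V
    bV : b ∉ V
    bV = x∈p─q⇒x∉q U V b∈U─V
    cV : c ∈ V
    cV = p─q⊆p V U c∈V─U
    cU : c ∉ U
    cU = x∈p─q⇒x∉q V U c∈V─U
    dU : d ∉ U
    dU = d∉U∪V ∘′ x∈p∪q⁺ ∘′ inj₁
    dV : d ∉ V
    dV = d∉U∪V ∘′ x∈p∪q⁺ ∘′ inj₂

    swapped : ∃[ b ] Twisted (V △ U) u b v → ∃[ b ] Twisted (U △ V) u b v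
    swapped (β , twisted) = β , subst (λ W → Twisted W u β v) (△-comm V U) twisted

    twisted-△ : (u ∈ U × u ∉ V) ⊎ (u ∈ V × u ∉ U) → (v ∈ U × v ∉ V) ⊎ (v ∈ V × v ∉ U) →
      ∃[ b ] Twisted (U △ V) u b v
    twisted-△ (inj₁ (uU , uV)) (inj₁ (vU , vV)) =
      twisted-△-sameSide MU MV cV cU uU uV vU vV
    twisted-△ (inj₁ (uU , uV)) (inj₂ (vV , vU)) =
      twisted-△-acrossSides MU MV aU aV dU dV uU uV vV vU
    twisted-△ (inj₂ (uV , uU)) (inj₂ (vV , vU)) =
      swapped (twisted-△-sameSide MV MU bU bV uV uU vV vU)
    twisted-△ (inj₂ (uV , uU)) (inj₁ (vU , vV)) =
      swapped (twisted-△-acrossSides MV MU aV aU dV dU uV uU vU vV)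

mainTheorem5 : {n : ℕ} (G : TwoStructure n) (𝓘 : FPFInvolution G)
    (U V : Subset n) →
    IsInvolutionModule G 𝓘 U → IsInvolutionModule G 𝓘 V → Crossing U V →
    IsInvolutionModule G 𝓘 (U △ V)
mainTheorem5 G 𝓘 U V MU MV crossing =
  twistModule⇒involutionModule G 𝓘
    (△-isTwistModule G 𝓘 (involutionModule⇒twistModule G 𝓘 MU)
                         (involutionModule⇒twistModule G 𝓘 MV) crossing)
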